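{- Let $k\ge1$ be odd. Then $$0\le n_3(k)\le\sqrt{\frac{3k-1}{2}}-1<\sqrt{\frac{3k}{2}}.$$ Moreover $n_3(k)=\sqrt{\frac{3k-1}{2}}-1$ if and only if $k=1+2+8+32+\dots+2\cdot4^{a-1}=1+2\,\frac{4^a-1}{3}$ for some integer $a\ge0$.
   Context: For an integer $k\ge0$ with binary expansion $k=\sum_{i\ge0}\beta_i2^i$, $n_3(k)=\sum_{i\text{ odd}}\beta_i2^{(i-1)/2}$. -}

module Defs where

open import Data.Nat using (ℕ; zero; suc; _+_; _*_; _^_; _/_; _%_)

sumBelow : ℕ → (ℕ → ℕ) → ℕ
sumBelow zero    f = 0
sumBelow (suc n) f = sumBelow n f + f n

bit : ℕ → ℕ → ℕ
bit zero    k = k % 2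
bit (suc i) k = bit i (k / 2)

-- n₃(k) = Σ_{i odd} β_i 2^{(i-1)/2} = Σ_{j ≥ 0} β_{2j+1} 2^j.
-- Only finitely many terms are nonzero: β_{2j+1}(k) = 0 once 2j+1 ≥ k
-- (as 2^(2j+1) > k), so summing over j < k covers all nonzero terms.
n₃ : ℕ → ℕ
n₃ k = sumBelow k (λ j → bit (1 + 2 * j) k * 2 ^ j)

special : ℕ → ℕ
special a = 1 + sumBelow a (λ i → 2 * 4 ^ i)

{-# OPTIONS --safe #-}

-- Write k = 1 + 2m. The odd-position binary digits of k are the even-position digits of m, so
-- n₃(k) = E(m), the number spelled by the even-position digits of m. Splitting off the lowest
-- base-4 digit, m = b + 2c + 4q, gives E(m) = b + 2E(q), and (E(m) + 1)² ≤ 1 + 3m follows by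
-- induction: the right side becomes 4(1 + 3q) + 6c − 3 + 3b, while the left side is 4(E(q) + 1)²
-- for b = 1 and 4(E(q) + 1)² − 4E(q) − 3 for b = 0. Equality thus forces c = 0 at every step
-- and b = 1 until m = 0, i.e. m = 1 + 4 + ⋯ + 4^(a−1); for such m, E(m) + 1 = 2^a and 1 + 3m = 4^a.

module Submission where

open import Defs
open import Data.Nat using (ℕ; zero; suc; _+_; _*_; _^_; _∸_; _%_; _/_; _≤_; _<_; z≤n; s≤s)
open import Data.Nat.Properties
open import Data.Nat.DivMod
open import Data.Nat.Divisibility using (m∣m*n)
open import Data.Nat.Solver using (module +-*-Solver)
open import Data.Product using (_×_; ∃; _,_)
open import Function.Bundles using (_⇔_; mk⇔; Equivalence)
open import Relation.Binary.PropositionalEquality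
open +-*-Solver
open import Algebra.Properties.CommutativeSemigroup *-commutativeSemigroup using (x∙yz≈y∙xz)

sumBelow-suc : ∀ N f → sumBelow (suc N) f ≡ f 0 + sumBelow N (λ j → f (suc j))
sumBelow-suc zero    f = +-comm 0 (f 0)
sumBelow-suc (suc N) f = trans (cong (_+ f (suc N)) (sumBelow-suc N f)) (+-assoc (f 0) _ _)

sumBelow-cong : ∀ N {f g} → (∀ j → f j ≡ g j) → sumBelow N f ≡ sumBelow N g
sumBelow-cong zero    f≗g = refl
sumBelow-cong (suc N) f≗g = cong₂ _+_ (sumBelow-cong N f≗g) (f≗g N)

sumBelow-*ˡ : ∀ c N f → sumBelow N (λ j → c * f j) ≡ c * sumBelow N f
sumBelow-*ˡ c zero    f = sym (*-zeroʳ c)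
sumBelow-*ˡ c (suc N) f =
  trans (cong (_+ c * f N) (sumBelow-*ˡ c N f)) (sym (*-distribˡ-+ c (sumBelow N f) (f N)))

[b+2x]%2≡b : ∀ {b} x → b ≤ 1 → (b + 2 * x) % 2 ≡ b
[b+2x]%2≡b {b} x b≤1 = begin
  (b + 2 * x) % 2  ≡⟨ cong (λ y → (b + y) % 2) (*-comm 2 x) ⟩
  (b + x * 2) % 2  ≡⟨ [m+kn]%n≡m%n b x 2 ⟩
  b % 2            ≡⟨ m<n⇒m%n≡m (s≤s b≤1) ⟩
  b                ∎
  where open ≡-Reasoning

[b+2x]/2≡x : ∀ {b} x → b ≤ 1 → (b + 2 * x) / 2 ≡ x
[b+2x]/2≡x {b} x b≤1 = begin
  (b + 2 * x) / 2    ≡⟨ +-distrib-/-∣ʳ b (m∣m*n x) ⟩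
  b / 2 + 2 * x / 2  ≡⟨ cong₂ _+_ (m<n⇒m/n≡0 (s≤s b≤1)) (/-congˡ (*-comm 2 x)) ⟩
  x * 2 / 2          ≡⟨ m*n/n≡m x 2 ⟩
  x                  ∎
  where open ≡-Reasoning

data Base2 : ℕ → Set where
  base2 : ∀ {b} x → b ≤ 1 → Base2 (b + 2 * x)

data Base4 : ℕ → Set where
  base4 : ∀ {b c} q → b ≤ 1 → c ≤ 1 → Base4 (b + 2 * (c + 2 * q))

base2-view : ∀ m → Base2 m
base2-view m = subst Base2 (sym m≡m%2+2*[m/2]) (base2 (m / 2) (<⇒≤pred (m%n<n m 2)))
  where
  m≡m%2+2*[m/2] : m ≡ m % 2 + 2 * (m / 2)
  m≡m%2+2*[m/2] = trans (m≡m%n+[m/n]*n m 2) (cong (m % 2 +_) (*-comm (m / 2) 2))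

base4-view : ∀ m → Base4 m
base4-view m with base2-view m
... | base2 x b≤1 with base2-view x
...   | base2 q c≤1 = base4 q b≤1 c≤1

bit-suc-digit : ∀ i {b} x → b ≤ 1 → bit (suc i) (b + 2 * x) ≡ bit i x
bit-suc-digit i x b≤1 = cong (bit i) ([b+2x]/2≡x x b≤1)

evenBits : ℕ → ℕ → ℕ
evenBits N m = sumBelow N (λ j → bit (2 * j) m * 2 ^ j)

n₃-odd : ∀ m → n₃ (1 + 2 * m) ≡ evenBits (1 + 2 * m) m
n₃-odd m = sumBelow-cong (1 + 2 * m) (λ j → cong (_* 2 ^ j) (bit-suc-digit (2 * j) m (s≤s z≤n)))

evenBits-base4 : ∀ N {b c} q → b ≤ 1 → c ≤ 1 →
                 evenBits (suc N) (b + 2 * (c + 2 * q)) ≡ b + 2 * evenBits N q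
evenBits-base4 N {b} {c} q b≤1 c≤1 = begin
  evenBits (suc N) m
    ≡⟨ sumBelow-suc N _ ⟩
  bit 0 m * 1 + sumBelow N (λ j → bit (2 * suc j) m * 2 ^ suc j)
    ≡⟨ cong₂ _+_ (trans (*-identityʳ _) ([b+2x]%2≡b (c + 2 * q) b≤1)) (sumBelow-cong N shift) ⟩
  b + sumBelow N (λ j → 2 * (bit (2 * j) q * 2 ^ j))
    ≡⟨ cong (b +_) (sumBelow-*ˡ 2 N _) ⟩
  b + 2 * evenBits N q
    ∎
  where
  open ≡-Reasoning
  m : ℕ
  m = b + 2 * (c + 2 * q)
  shift : ∀ j → bit (2 * suc j) m * 2 ^ suc j ≡ 2 * (bit (2 * j) q * 2 ^ j)
  shift j = begin
    bit (2 * suc j) m * (2 * 2 ^ j)        ≡⟨ cong (λ i → bit i m * (2 * 2 ^ j)) (*-suc 2 j) ⟩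
    bit (suc (suc (2 * j))) m * (2 * 2 ^ j) ≡⟨ cong (_* (2 * 2 ^ j)) bit-drop-two-digits ⟩
    bit (2 * j) q * (2 * 2 ^ j)            ≡⟨ x∙yz≈y∙xz (bit (2 * j) q) 2 (2 ^ j) ⟩
    2 * (bit (2 * j) q * 2 ^ j)            ∎
    where
    bit-drop-two-digits : bit (suc (suc (2 * j))) m ≡ bit (2 * j) q
    bit-drop-two-digits = trans (bit-suc-digit (suc (2 * j)) (c + 2 * q) b≤1) (bit-suc-digit (2 * j) q c≤1)

evenBits-zero : ∀ N → evenBits N 0 ≡ 0
evenBits-zero zero    = refl
evenBits-zero (suc N) = trans (evenBits-base4 N 0 z≤n z≤n) (cong (2 *_) (evenBits-zero N))

1≡1+3*m⇒m≡0 : ∀ {m} → 1 ≡ 1 + 3 * m → m ≡ 0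
1≡1+3*m⇒m≡0 {zero} _ = refl

m+n≤m⇒n≡0 : ∀ m {n} → m + n ≤ m → n ≡ 0
m+n≤m⇒n≡0 m {n} m+n≤m = n≤0⇒n≡0 (+-cancelˡ-≤ m n 0 (≤-trans m+n≤m (≤-reflexive (sym (+-identityʳ m)))))

1+3*[1+4q]≡4*[1+3q] : ∀ q → 1 + 3 * (1 + 2 * (2 * q)) ≡ 4 * (1 + 3 * q)
1+3*[1+4q]≡4*[1+3q] = solve 1 (λ q → con 1 :+ con 3 :* (con 1 :+ con 2 :* (con 2 :* q))
                                   := con 4 :* (con 1 :+ con 3 :* q)) refl

[1+2e+1]^2≡4*[e+1]^2 : ∀ e → (1 + 2 * e + 1) ^ 2 ≡ 4 * (e + 1) ^ 2
[1+2e+1]^2≡4*[e+1]^2 = solve 1 (λ e → (con 1 :+ con 2 :* e :+ con 1) :^ 2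
                                    := con 4 :* (e :+ con 1) :^ 2) refl

[2e+1]^2+4e+3≡4*[e+1]^2 : ∀ e → (2 * e + 1) ^ 2 + 4 * e + 3 ≡ 4 * (e + 1) ^ 2
[2e+1]^2+4e+3≡4*[e+1]^2 = solve 1 (λ e → (con 2 :* e :+ con 1) :^ 2 :+ con 4 :* e :+ con 3
                                       := con 4 :* (e :+ con 1) :^ 2) refl

even-digit-bound : ∀ e q c → (e + 1) ^ 2 ≤ 1 + 3 * q →
                   (2 * e + 1) ^ 2 + 4 * e ≤ 1 + 3 * (2 * (c + 2 * q))
even-digit-bound e q c h = +-cancelʳ-≤ 3 _ _ (begin
  (2 * e + 1) ^ 2 + 4 * e + 3      ≡⟨ [2e+1]^2+4e+3≡4*[e+1]^2 e ⟩
  4 * (e + 1) ^ 2                  ≤⟨ *-monoʳ-≤ 4 h ⟩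
  4 * (1 + 3 * q)                  ≤⟨ m≤m+n _ (6 * c) ⟩
  4 * (1 + 3 * q) + 6 * c          ≡⟨ digit-identity ⟩
  1 + 3 * (2 * (c + 2 * q)) + 3    ∎)
  where
  open ≤-Reasoning
  digit-identity : 4 * (1 + 3 * q) + 6 * c ≡ 1 + 3 * (2 * (c + 2 * q)) + 3
  digit-identity = solve 2 (λ q c → con 4 :* (con 1 :+ con 3 :* q) :+ con 6 :* c
                                := con 1 :+ con 3 :* (con 2 :* (c :+ con 2 :* q)) :+ con 3) refl q c

odd-digit-bound : ∀ e q c → (e + 1) ^ 2 ≤ 1 + 3 * q →
                  (1 + 2 * e + 1) ^ 2 + 6 * c ≤ 1 + 3 * (1 + 2 * (c + 2 * q))
odd-digit-bound e q c h = begin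
  (1 + 2 * e + 1) ^ 2 + 6 * c      ≡⟨ cong (_+ 6 * c) ([1+2e+1]^2≡4*[e+1]^2 e) ⟩
  4 * (e + 1) ^ 2 + 6 * c          ≤⟨ +-monoˡ-≤ (6 * c) (*-monoʳ-≤ 4 h) ⟩
  4 * (1 + 3 * q) + 6 * c          ≡⟨ digit-identity ⟩
  1 + 3 * (1 + 2 * (c + 2 * q))    ∎
  where
  open ≤-Reasoning
  digit-identity : 4 * (1 + 3 * q) + 6 * c ≡ 1 + 3 * (1 + 2 * (c + 2 * q))
  digit-identity = solve 2 (λ q c → con 4 :* (con 1 :+ con 3 :* q) :+ con 6 :* c
                                := con 1 :+ con 3 :* (con 1 :+ con 2 :* (c :+ con 2 :* q))) refl q c

even-digit-tight : ∀ e q c → (e + 1) ^ 2 ≤ 1 + 3 * q →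
                   (2 * e + 1) ^ 2 ≡ 1 + 3 * (2 * (c + 2 * q)) → 2 * (c + 2 * q) ≡ 0
even-digit-tight e q c h eq = 1≡1+3*m⇒m≡0 (subst (λ x → (2 * x + 1) ^ 2 ≡ _) e≡0 eq)
  where
  e≡0 : e ≡ 0
  e≡0 = *-cancelˡ-≡ e 0 4 (m+n≤m⇒n≡0 _ (≤-trans (even-digit-bound e q c h) (≤-reflexive (sym eq))))

odd-digit-tight : ∀ e q c → (e + 1) ^ 2 ≤ 1 + 3 * q →
                  (1 + 2 * e + 1) ^ 2 ≡ 1 + 3 * (1 + 2 * (c + 2 * q)) →
                  c ≡ 0 × (e + 1) ^ 2 ≡ 1 + 3 * q
odd-digit-tight e q c h eq = c≡0 , *-cancelˡ-≡ _ _ 4 (begin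
  4 * (e + 1) ^ 2                  ≡⟨ [1+2e+1]^2≡4*[e+1]^2 e ⟨
  (1 + 2 * e + 1) ^ 2              ≡⟨ eq ⟩
  1 + 3 * (1 + 2 * (c + 2 * q))    ≡⟨ cong (λ x → 1 + 3 * (1 + 2 * (x + 2 * q))) c≡0 ⟩
  1 + 3 * (1 + 2 * (2 * q))        ≡⟨ 1+3*[1+4q]≡4*[1+3q] q ⟩
  4 * (1 + 3 * q)                  ∎)
  where
  open ≡-Reasoning
  c≡0 : c ≡ 0
  c≡0 = *-cancelˡ-≡ c 0 6 (m+n≤m⇒n≡0 _ (≤-trans (odd-digit-bound e q c h) (≤-reflexive (sym eq))))

evenBits-bound : ∀ N m → (evenBits N m + 1) ^ 2 ≤ 1 + 3 * m
evenBits-bound zero    m = s≤s z≤n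
evenBits-bound (suc N) m with base4-view m
... | base4 {b} {c} q b≤1 c≤1 rewrite evenBits-base4 N q b≤1 c≤1 with b≤1
...   | z≤n     = ≤-trans (m≤m+n _ _) (even-digit-bound (evenBits N q) q c (evenBits-bound N q))
...   | s≤s z≤n = ≤-trans (m≤m+n _ _) (odd-digit-bound (evenBits N q) q c (evenBits-bound N q))

repunit₄ : ℕ → ℕ
repunit₄ a = sumBelow a (4 ^_)

-- in the shape b + 2 * (c + 2 * q) of a base-4 digit split, with b = 1 and c = 0
repunit₄-suc : ∀ a → repunit₄ (suc a) ≡ 1 + 2 * (2 * repunit₄ a)
repunit₄-suc a = begin
  repunit₄ (suc a)                   ≡⟨ sumBelow-suc a (4 ^_) ⟩
  1 + sumBelow a (λ j → 4 * 4 ^ j)  ≡⟨ cong (1 +_) (sumBelow-*ˡ 4 a (4 ^_)) ⟩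
  1 + 4 * repunit₄ a                 ≡⟨ cong (1 +_) (*-assoc 2 2 (repunit₄ a)) ⟩
  1 + 2 * (2 * repunit₄ a)           ∎
  where open ≡-Reasoning

evenBits-tight : ∀ N m → (evenBits N m + 1) ^ 2 ≡ 1 + 3 * m → ∃ λ a → m ≡ repunit₄ a
evenBits-tight zero    m eq = 0 , 1≡1+3*m⇒m≡0 eq
evenBits-tight (suc N) m eq with base4-view m
... | base4 {b} {c} q b≤1 c≤1 rewrite evenBits-base4 N q b≤1 c≤1 with b≤1
...   | z≤n     = 0 , even-digit-tight (evenBits N q) q c (evenBits-bound N q) eq
...   | s≤s z≤n with odd-digit-tight (evenBits N q) q c (evenBits-bound N q) eq
...     | refl , eq′ with evenBits-tight N q eq′
...       | a , refl = suc a , sym (repunit₄-suc a)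

n≤repunit₄ : ∀ n → n ≤ repunit₄ n
n≤repunit₄ zero    = z≤n
n≤repunit₄ (suc n) = subst (suc n ≤_) (sym (repunit₄-suc n))
  (s≤s (≤-trans (n≤repunit₄ n) (≤-trans (m≤n*m _ 2) (m≤n*m _ 2))))

1+3*repunit₄≡4^ : ∀ a → 1 + 3 * repunit₄ a ≡ 4 ^ a
1+3*repunit₄≡4^ zero    = refl
1+3*repunit₄≡4^ (suc a) = begin
  1 + 3 * repunit₄ (suc a)                ≡⟨ cong (λ r → 1 + 3 * r) (repunit₄-suc a) ⟩
  1 + 3 * (1 + 2 * (2 * repunit₄ a))      ≡⟨ 1+3*[1+4q]≡4*[1+3q] (repunit₄ a) ⟩
  4 * (1 + 3 * repunit₄ a)                ≡⟨ cong (4 *_) (1+3*repunit₄≡4^ a) ⟩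
  4 ^ suc a                               ∎
  where open ≡-Reasoning

evenBits-repunit₄ : ∀ {N a} → a ≤ N → evenBits N (repunit₄ a) + 1 ≡ 2 ^ a
evenBits-repunit₄ {N}     {zero}  _         = cong (_+ 1) (evenBits-zero N)
evenBits-repunit₄ {suc N} {suc a} (s≤s a≤N) = begin
  evenBits (suc N) (repunit₄ (suc a)) + 1      ≡⟨ cong (λ m → evenBits (suc N) m + 1) (repunit₄-suc a) ⟩
  evenBits (suc N) (1 + 2 * (2 * r)) + 1       ≡⟨ cong (_+ 1) (evenBits-base4 N r (s≤s z≤n) z≤n) ⟩
  1 + 2 * evenBits N r + 1                     ≡⟨ 1+2e+1≡2*[e+1] (evenBits N r) ⟩
  2 * (evenBits N r + 1)                       ≡⟨ cong (2 *_) (evenBits-repunit₄ a≤N) ⟩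
  2 ^ suc a                                    ∎
  where
  open ≡-Reasoning
  r : ℕ
  r = repunit₄ a
  1+2e+1≡2*[e+1] : ∀ e → 1 + 2 * e + 1 ≡ 2 * (e + 1)
  1+2e+1≡2*[e+1] = solve 1 (λ e → con 1 :+ con 2 :* e :+ con 1 := con 2 :* (e :+ con 1)) refl

[2^a]^2≡4^a : ∀ a → (2 ^ a) ^ 2 ≡ 4 ^ a
[2^a]^2≡4^a a = begin
  (2 ^ a) ^ 2    ≡⟨ ^-*-assoc 2 a 2 ⟩
  2 ^ (a * 2)    ≡⟨ cong (2 ^_) (*-comm a 2) ⟩
  2 ^ (2 * a)    ≡⟨ ^-*-assoc 2 2 a ⟨
  4 ^ a          ∎
  where open ≡-Reasoning

evenBits-repunit₄-tight : ∀ {N a} → a ≤ N → (evenBits N (repunit₄ a) + 1) ^ 2 ≡ 1 + 3 * repunit₄ a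
evenBits-repunit₄-tight {N} {a} a≤N = begin
  (evenBits N (repunit₄ a) + 1) ^ 2   ≡⟨ cong (_^ 2) (evenBits-repunit₄ a≤N) ⟩
  (2 ^ a) ^ 2                         ≡⟨ [2^a]^2≡4^a a ⟩
  4 ^ a                               ≡⟨ 1+3*repunit₄≡4^ a ⟨
  1 + 3 * repunit₄ a                  ∎
  where open ≡-Reasoning

special≡1+2*repunit₄ : ∀ a → special a ≡ 1 + 2 * repunit₄ a
special≡1+2*repunit₄ a = cong (1 +_) (sumBelow-*ˡ 2 a (4 ^_))

evenBits-tight⇔special : ∀ m →
  (evenBits (1 + 2 * m) m + 1) ^ 2 ≡ 1 + 3 * m ⇔ ∃ λ a → 1 + 2 * m ≡ special a
evenBits-tight⇔special m = mk⇔ tight⇒special special⇒tight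
  where
  tight⇒special : (evenBits (1 + 2 * m) m + 1) ^ 2 ≡ 1 + 3 * m → ∃ λ a → 1 + 2 * m ≡ special a
  tight⇒special eq = let a , m≡r = evenBits-tight (1 + 2 * m) m eq in
    a , trans (cong (λ x → 1 + 2 * x) m≡r) (sym (special≡1+2*repunit₄ a))
  special⇒tight : (∃ λ a → 1 + 2 * m ≡ special a) → (evenBits (1 + 2 * m) m + 1) ^ 2 ≡ 1 + 3 * m
  special⇒tight (a , k≡s) = subst (λ x → (evenBits (1 + 2 * x) x + 1) ^ 2 ≡ 1 + 3 * x) (sym m≡r)
    (evenBits-repunit₄-tight (≤-trans (n≤repunit₄ a) (≤-trans (m≤n*m _ 2) (n≤1+n _))))
    where
    m≡r : m ≡ repunit₄ a
    m≡r = *-cancelˡ-≡ _ _ 2 (suc-injective (trans k≡s (special≡1+2*repunit₄ a)))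

3*[1+2m]≡1+2*[1+3m] : ∀ m → 3 * (1 + 2 * m) ≡ 1 + 2 * (1 + 3 * m)
3*[1+2m]≡1+2*[1+3m] = solve 1 (λ m → con 3 :* (con 1 :+ con 2 :* m)
                                 := con 1 :+ con 2 :* (con 1 :+ con 3 :* m)) refl

proposition5p6 : ∀ (k : ℕ) → k % 2 ≡ 1 →
    (0 ≤ n₃ k)
    × (2 * (n₃ k + 1) ^ 2 ≤ 3 * k ∸ 1)
    × (2 * n₃ k ^ 2 < 3 * k)
    × ((2 * (n₃ k + 1) ^ 2 ≡ 3 * k ∸ 1) ⇔ ∃ (λ a → k ≡ special a))
proposition5p6 k k-odd with base2-view k
... | base2 m z≤n with () ← trans (sym ([b+2x]%2≡b m z≤n)) k-odd
... | base2 m (s≤s z≤n) rewrite n₃-odd m =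
  z≤n , ≤-trans bound (≤-reflexive (sym 3k∸1≡2*[1+3m])) , 2e²<3k , mk⇔
    (λ eq → Equivalence.to (evenBits-tight⇔special m) (*-cancelˡ-≡ _ _ 2 (trans eq 3k∸1≡2*[1+3m])))
    (λ s → trans (cong (2 *_) (Equivalence.from (evenBits-tight⇔special m) s)) (sym 3k∸1≡2*[1+3m]))
  where
  open ≤-Reasoning
  e : ℕ
  e = evenBits (1 + 2 * m) m
  3k∸1≡2*[1+3m] : 3 * (1 + 2 * m) ∸ 1 ≡ 2 * (1 + 3 * m)
  3k∸1≡2*[1+3m] = cong (_∸ 1) (3*[1+2m]≡1+2*[1+3m] m)
  bound : 2 * (e + 1) ^ 2 ≤ 2 * (1 + 3 * m)
  bound = *-monoʳ-≤ 2 (evenBits-bound (1 + 2 * m) m)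
  2e²<3k : 2 * e ^ 2 < 3 * (1 + 2 * m)
  2e²<3k = begin-strict
    2 * e ^ 2            ≤⟨ *-monoʳ-≤ 2 (^-monoˡ-≤ 2 (m≤m+n e 1)) ⟩
    2 * (e + 1) ^ 2      ≤⟨ bound ⟩
    2 * (1 + 3 * m)      <⟨ n<1+n _ ⟩
    1 + 2 * (1 + 3 * m)  ≡⟨ 3*[1+2m]≡1+2*[1+3m] m ⟨
    3 * (1 + 2 * m)      ∎
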